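{- For every rational $u$ with $u^2\neq 1$, let $p = u^4-u^2+1$, $q = u(2u^2-1)$, $r = 2u^2-1$, $s = u(u^4-1)$ and $a = \frac{1}{u^2-1}$. Then $pq(p^2+q^2) = a\,rs(r^2+s^2)$; equivalently $A=p+q$, $B=r-s$, $C=p-q$, $D=r+s$ satisfy $A^4 + aB^4 = C^4 + aD^4$. -}

module Defs where

open import Data.Rational using (ℚ; 0ℚ; 1ℚ; _+_; _-_; _*_; -_; 1/_; NonZero; ≢-nonZero)
open import Data.Rational.Properties using (+-assoc; +-inverseˡ; +-identityʳ; +-identityˡ)
open import Relation.Binary.PropositionalEquality
open import Relation.Nullary using (¬_)

private
  x-1≡0⇒x≡1 : ∀ x → x - 1ℚ ≡ 0ℚ → x ≡ 1ℚ
  x-1≡0⇒x≡1 x h = begin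
      x                      ≡⟨ sym (+-identityʳ x) ⟩
      x + 0ℚ                 ≡⟨ cong (x +_) (sym (+-inverseˡ 1ℚ)) ⟩
      x + (- 1ℚ + 1ℚ)        ≡⟨ sym (+-assoc x (- 1ℚ) 1ℚ) ⟩
      (x - 1ℚ) + 1ℚ          ≡⟨ cong (_+ 1ℚ) h ⟩
      0ℚ + 1ℚ                ≡⟨ +-identityˡ 1ℚ ⟩
      1ℚ                     ∎
    where open ≡-Reasoning

u²-1-nonZero : ∀ u → u * u ≢ 1ℚ → NonZero (u * u - 1ℚ)
u²-1-nonZero u h = ≢-nonZero (λ e → h (x-1≡0⇒x≡1 (u * u) e))

aOf : (u : ℚ) → u * u ≢ 1ℚ → ℚ
aOf u h = 1/_ (u * u - 1ℚ) {{u²-1-nonZero u h}}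

module Submission where

-- Write X(u) = pq(p² + q²) and Y(u) = rs(r² + s²).  A direct polynomial
-- computation shows X(u) · (u² − 1) = Y(u); multiplying by a = 1/(u² − 1)
-- gives the first claim X = a·Y.  The second claim follows from the binomial
-- identity (x + y)⁴ − (x − y)⁴ = 8xy(x² + y²): applied to (p, q) and (r, s)
-- it turns X = a·Y into (p + q)⁴ − (p − q)⁴ = a·((r + s)⁴ − (r − s)⁴), which
-- rearranges to A⁴ + aB⁴ = C⁴ + aD⁴.

open import Defs
open import Data.Rational using (ℚ; 0ℚ; 1ℚ; _+_; _-_; _*_; _≟_)
open import Data.Rational.Properties using (+-*-commutativeRing; *-inverseˡ; *-identityˡ; *-assoc; *-comm)
open import Data.Product using (_×_; _,_)
open import Relation.Nullary.Decidable using (dec⇒maybe)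
open import Relation.Binary.PropositionalEquality
open import Tactic.RingSolver using (solve-∀)
open import Tactic.RingSolver.Core.AlmostCommutativeRing using (AlmostCommutativeRing; fromCommutativeRing)
open import Level using (0ℓ)

private
  ℚ-ring : AlmostCommutativeRing 0ℓ 0ℓ
  ℚ-ring = fromCommutativeRing +-*-commutativeRing (λ x → dec⇒maybe (0ℚ ≟ x))

⁴ : ℚ → ℚ
⁴ x = (x * x) * (x * x)

-- The constant 8 = 2³, built from 1 so that the solver treats it as a numeral.
eight : ℚ
eight = (1ℚ + 1ℚ) * (1ℚ + 1ℚ) * (1ℚ + 1ℚ)

quartic : ℚ → ℚ → ℚ
quartic x y = x * y * (x * x + y * y)

-- Binomial identity: (x + y)⁴ = (x − y)⁴ + 8xy(x² + y²).
-- (The solver sees only the expanded polynomials, so the lemma is stated with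
-- the abbreviations unfolded; the two forms agree definitionally.)
fourth-sum-difference : ∀ x y → ⁴ (x + y) ≡ ⁴ (x - y) + eight * quartic x y
fourth-sum-difference = expanded
  where
  expanded : ∀ x y → ((x + y) * (x + y)) * ((x + y) * (x + y))
    ≡ ((x - y) * (x - y)) * ((x - y) * (x - y))
      + (1ℚ + 1ℚ) * (1ℚ + 1ℚ) * (1ℚ + 1ℚ) * (x * y * (x * x + y * y))
  expanded = solve-∀ ℚ-ring

parametric-identity : ∀ u →
  let two = 1ℚ + 1ℚ
      u² = u * u
      u⁴ = u² * u²
  in quartic (u⁴ - u² + 1ℚ) (u * (two * u² - 1ℚ)) * (u² - 1ℚ)
     ≡ quartic (two * u² - 1ℚ) (u * (u⁴ - 1ℚ))
parametric-identity = expanded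
  where
  expanded : ∀ u →
    let two = 1ℚ + 1ℚ
        u² = u * u
        u⁴ = u² * u²
        p = u⁴ - u² + 1ℚ
        q = u * (two * u² - 1ℚ)
        r = two * u² - 1ℚ
        s = u * (u⁴ - 1ℚ)
    in p * q * (p * p + q * q) * (u² - 1ℚ) ≡ r * s * (r * r + s * s)
  expanded = solve-∀ ℚ-ring

cancel-by-inverse : ∀ {X Y a d} → a * d ≡ 1ℚ → X * d ≡ Y → X ≡ a * Y
cancel-by-inverse {X} {Y} {a} {d} inv eq = begin
  X             ≡⟨ sym (*-identityˡ X) ⟩
  1ℚ * X        ≡⟨ cong (_* X) (sym inv) ⟩
  (a * d) * X   ≡⟨ *-assoc a d X ⟩
  a * (d * X)   ≡⟨ cong (a *_) (trans (*-comm d X) eq) ⟩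
  a * Y         ∎
  where open ≡-Reasoning

fourth-powers-balance : ∀ a x y z w → quartic x y ≡ a * quartic z w →
  ⁴ (x + y) + a * ⁴ (z - w) ≡ ⁴ (x - y) + a * ⁴ (z + w)
fourth-powers-balance a x y z w eq = begin
  ⁴ (x + y) + a * ⁴ (z - w)
    ≡⟨ cong (_+ a * ⁴ (z - w)) (fourth-sum-difference x y) ⟩
  ⁴ (x - y) + eight * quartic x y + a * ⁴ (z - w)
    ≡⟨ cong (λ t → ⁴ (x - y) + eight * t + a * ⁴ (z - w)) eq ⟩
  ⁴ (x - y) + eight * (a * quartic z w) + a * ⁴ (z - w)
    ≡⟨ regroup a (⁴ (x - y)) (⁴ (z - w)) (quartic z w) ⟩
  ⁴ (x - y) + a * (⁴ (z - w) + eight * quartic z w)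
    ≡⟨ cong (λ t → ⁴ (x - y) + a * t) (sym (fourth-sum-difference z w)) ⟩
  ⁴ (x - y) + a * ⁴ (z + w)
    ∎
  where
  open ≡-Reasoning
  regroup : ∀ k c b t → c + (1ℚ + 1ℚ) * (1ℚ + 1ℚ) * (1ℚ + 1ℚ) * (k * t) + k * b
                      ≡ c + k * (b + (1ℚ + 1ℚ) * (1ℚ + 1ℚ) * (1ℚ + 1ℚ) * t)
  regroup = solve-∀ ℚ-ring

mainTheorem12 : (u : ℚ) → (h : u * u ≢ 1ℚ) →
    let u² = u * u
        u⁴ = u² * u²
        two = 1ℚ + 1ℚ
        p = u⁴ - u² + 1ℚ
        q = u * (two * u² - 1ℚ)
        r = two * u² - 1ℚ
        s = u * (u⁴ - 1ℚ)
        a = aOf u h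
        A = p + q
        B = r - s
        C = p - q
        D = r + s
        ⁴ : ℚ → ℚ
        ⁴ x = (x * x) * (x * x)
    in (p * q * (p * p + q * q) ≡ a * r * s * (r * r + s * s))
       × (⁴ A + a * ⁴ B ≡ ⁴ C + a * ⁴ D)
mainTheorem12 u h =
  trans X≡aY (reassociate a r s (r * r + s * s)) ,
  fourth-powers-balance a p q r s X≡aY
  where
  two p q r s a : ℚ
  two = 1ℚ + 1ℚ
  p = (u * u) * (u * u) - u * u + 1ℚ
  q = u * (two * (u * u) - 1ℚ)
  r = two * (u * u) - 1ℚ
  s = u * ((u * u) * (u * u) - 1ℚ)
  a = aOf u h

  a-inverse : a * (u * u - 1ℚ) ≡ 1ℚ
  a-inverse = *-inverseˡ (u * u - 1ℚ) {{u²-1-nonZero u h}}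

  X≡aY : quartic p q ≡ a * quartic r s
  X≡aY = cancel-by-inverse {a = a} a-inverse (parametric-identity u)

  reassociate : ∀ b x y t → b * (x * y * t) ≡ b * x * y * t
  reassociate = solve-∀ ℚ-ring
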